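{- Consider the algorithm $\mathcal A$ described in the context, run on a valid W$k$S-RSP input $(\sigma_1,\ell_1),\dots,(\sigma_T,\ell_T)$ with $\ell_1=k$. For every $t\in\{1,\dots,T\}$ the following hold with probability one: (1) for every $\ell\in\{0,\dots,k\}$ there exists a feasible labeling $\gamma$ of $\mathcal I_t$ with respect to $\rho_t$ such that $\gamma(L^i_t)=s^i_t$ for all $i\in\{\ell+1,\dots,k\}$; (2) for every $\ell\in\{1,\dots,k\}$ the set $Q^\ell_t(s^{\ell+1}_t,\dots,s^k_t)$ is nonempty; (3) the algorithm serves the $t$-th request, i.e. $\sigma_t\in\{s^1_t,\dots,s^k_t\}$.
   Context: $U$ is a finite set (uniform metric). A hierarchical service pattern over $[1,s+1)$ is a $k$-tuple $\mathcal I=(\mathcal I^1,\dots,\mathcal I^k)$ of partitions of $[1,s+1)$ into left-closed right-open integer intervals with $\mathcal I^\ell$ refining $\mathcal I^{\ell+1}$. A labeling maps the multiset $\mathcal I^1\uplus\dots\uplus\mathcal I^k$ to $U$; it is feasible with respect to $(\sigma_1,\dots,\sigma_s)$ if each $r\le s$ lies in some interval labeled $\sigma_r$. The $\ell$-extension of a pattern $\mathcal I_{t-1}$ over $[1,t)$ adds $[t,t+1)$ as a new interval to each level $i\le\ell$ and extends the last interval of each level $i>\ell$ by $[t,t+1)$. A valid W$k$S-RSP input is a sequence of pairs $(\sigma_t,\ell_t)\in U\times\{0,\dots,k\}$ such that, with $\mathcal I_t$ the $\ell_t$-extension of $\mathcal I_{t-1}$, each $\mathcal I_t$ is feasible with respect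 to $\rho_t=(\sigma_1,\dots,\sigma_t)$. $L^i_t$ is the last interval of $\mathcal I^i_t$. $Q^\ell_t(p^{\ell+1},\dots,p^k)$ is the set of $p^\ell\in U$ such that some feasible labeling $\gamma$ of $\mathcal I_t$ w.r.t. $\rho_t$ has $\gamma(L^i_t)=p^i$ for all $i\in\{\ell,\dots,k\}$. Algorithm $\mathcal A$: $s^\ell_t$ denotes the position of its $\ell$-th server after round $t$. In round $t$: set flag $:=$ false; for $\ell=k,k-1,\dots,1$: compute $Q:=Q^\ell_t(s^{\ell+1}_t,\dots,s^k_t)$; if flag is true or $\ell\le\ell_t$, set $s^\ell_t$ to a uniformly random point of $Q$ (a forced movement); else if $s^\ell_{t-1}\notin Q$, set $s^\ell_t$ to a uniformly random point of $Q$ (an unforced movement) and set flag $:=$ true; else set $s^\ell_t:=s^\ell_{t-1}$. -}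

module Defs where

open import Data.Nat using (ℕ; zero; suc; _+_; _≤_; _<_; _≤?_; _∸_)
open import Data.Fin using (Fin)
open import Data.Bool using (Bool; true; false; if_then_else_)
open import Data.List using (List; []; _∷_)
open import Data.List.Membership.Propositional using (_∈_)
open import Data.Product using (Σ; ∃; _×_; _,_)
open import Data.Sum using (_⊎_)
open import Relation.Nullary using (¬_; does)
open import Relation.Binary.PropositionalEquality using (_≡_)

record Interval : Set where
  constructor [_,_⟩
  field
    lo : ℕ
    hi : ℕ
open Interval public

_∈I_ : ℕ → Interval → Set
r ∈I J = lo J ≤ r × r < hi J

-- Extend the last interval [a,b) of a partition (stored most recent first)
-- to [a,b+1).
extendLast : List Interval → List Interval
extendLast []            = []
extendLast ([ a , b ⟩ ∷ Js) = [ a , suc b ⟩ ∷ Js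

-- The algorithm and the notions depending on the input.
--   n   : U = Fin n (finite set, uniform metric)
--   k   : number of levels / servers (levels are 1..k)
--   σ t : the requested point of round t   (t = 1, 2, ...)
--   lev t : the level ℓ_t of round t
module Alg {n : ℕ} (k : ℕ) (σ : ℕ → Fin n) (lev : ℕ → ℕ) where

  U : Set
  U = Fin n

  -- Level i of the pattern I_t, as the list of its intervals with the
  -- LAST interval L^i_t at the head.  I_0 is empty on every level and
  -- I_t is the (lev t)-extension of I_{t-1}.
  part : ℕ → ℕ → List Interval
  part i zero    = []
  part i (suc t) =
    if does (i ≤? lev (suc t))
      then [ suc t , suc (suc t) ⟩ ∷ part i t
      else extendLast (part i t)

  data IsLast : List Interval → Interval → Set where
    here : ∀ {J Js} → IsLast (J ∷ Js) J

  -- A labeling of the multiset I^1_t ⊎ ... ⊎ I^k_t: the element (level i,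
  -- interval J ∈ I^i_t) gets label γ i J (values elsewhere are irrelevant).
  Labeling : Set
  Labeling = ℕ → Interval → U

  Feasible : ℕ → Labeling → Set
  Feasible t γ = ∀ r → 1 ≤ r → r ≤ t →
    Σ ℕ λ i → 1 ≤ i × i ≤ k ×
      Σ Interval λ J → J ∈ part i t × r ∈I J × γ i J ≡ σ r

  LastLabel : Labeling → ℕ → ℕ → U → Set
  LastLabel γ i t p = Σ Interval λ J → IsLast (part i t) J × γ i J ≡ p

  ValidInput : ℕ → Set
  ValidInput T = ∀ t → 1 ≤ t → t ≤ T →
    lev t ≤ k × Σ Labeling λ γ → Feasible t γ

  Config : Set
  Config = ℕ → U

  InQ : ℕ → ℕ → Config → U → Set
  InQ ℓ t s x = Σ Labeling λ γ → Feasible t γ ×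
    LastLabel γ ℓ t x ×
    (∀ i → ℓ < i → i ≤ k → LastLabel γ i t (s i))

  -- The possible behaviours of algorithm A in round t on levels ℓ, ℓ-1, …, 1,
  -- given the flag value when level ℓ is processed, old positions (after
  -- round t-1) and new positions (after round t).  Uniformly random choices
  -- from Q are modelled by allowing any point of Q (the support).
  data Levels (t : ℕ) (old new : Config) : Bool → ℕ → Set where
    done     : ∀ {f} → Levels t old new f zero
    forced   : ∀ {f ℓ} → (f ≡ true ⊎ suc ℓ ≤ lev t) →
               InQ (suc ℓ) t new (new (suc ℓ)) →
               Levels t old new f ℓ → Levels t old new f (suc ℓ)
    unforced : ∀ {ℓ} → lev t < suc ℓ →
               ¬ InQ (suc ℓ) t new (old (suc ℓ)) →
               InQ (suc ℓ) t new (new (suc ℓ)) →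
               Levels t old new true ℓ → Levels t old new false (suc ℓ)
    stay     : ∀ {ℓ} → lev t < suc ℓ →
               InQ (suc ℓ) t new (old (suc ℓ)) →
               new (suc ℓ) ≡ old (suc ℓ) →
               Levels t old new false ℓ → Levels t old new false (suc ℓ)

  Step : ℕ → Config → Config → Set
  Step t old new = Levels t old new false k

  RunUpTo : ℕ → (ℕ → Config) → Set
  RunUpTo t c = ∀ u → 1 ≤ u → u ≤ t → Step u (c (u ∸ 1)) (c u)

{-# OPTIONS --safe #-}

-- Invariant: the servers above level ℓ sit on the last labels of a feasible
-- labeling (property (1)). A point of Q^ℓ comes with such a labeling that also
-- puts it on L^ℓ_t, and that labeling's label of L^(ℓ-1)_t lies in Q^(ℓ-1); so
-- processing levels k, …, 1 never meets an empty Q (every level has a last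
-- interval since ℓ₁ = k), and validity of the input starts the descent at k.
-- At ℓ = 0 the whole configuration is the last labels of a feasible labeling,
-- and σ_t can only be covered by a last interval, so some server is at σ_t.
-- Whether the old position lies in Q is decidable because feasibility only
-- depends on the labels of the finitely many intervals of the pattern.

module Submission where

open import Defs
open import Data.Nat using (ℕ; zero; suc; z≤n; s≤s; _≤_; _<_; _∸_; _≟_; _≤?_; _<?_; _≤ᵇ_)
open import Data.Nat.Properties using (≤-refl; ≤-trans; ≤-pred; <⇒≤; <⇒≱; m≤n⇒m≤1+n; m≤n⇒m<n∨m≡n; ≤⇒≤ᵇ; >⇒≢; ≰⇒>)
open import Data.Fin using (Fin)
import Data.Fin as Fin
open import Data.Fin.Properties using (any?)
open import Data.Bool using (Bool; true; false)
open import Data.List using (List; []; _∷_; map; concatMap; upTo)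
open import Data.List.Membership.Propositional using (_∈_; find; lose)
open import Data.List.Membership.Propositional.Properties using (∈-map⁺; ∈-concatMap⁺; ∈-upTo⁺)
open import Data.List.Relation.Unary.All as All using (All; []; _∷_)
import Data.List.Relation.Unary.Any as Any
open import Data.Product using (Σ; ∃; _×_; _,_; proj₂; curry; uncurry)
open import Data.Product.Properties using (≡-dec)
open import Data.Sum using (_⊎_; inj₁; inj₂)
open import Data.Unit using (⊤; tt)
open import Function using (_∘_)
open import Relation.Binary.Definitions using (DecidableEquality)
open import Relation.Binary.PropositionalEquality using (_≡_; _≢_; refl; sym; trans; cong; subst; module ≡-Reasoning)
open import Relation.Nullary using (Dec; yes; no; contradiction)
open import Relation.Nullary.Decidable using (map′; _×-dec_; _⊎-dec_; _→-dec_)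
open import Relation.Unary using (Decidable)

≤-suc-elim : {P : ℕ → Set} {m : ℕ} → P (suc m) → (∀ {j} → j ≤ m → P j) →
             ∀ {j} → j ≤ suc m → P j
≤-suc-elim p₁₊ₘ p≤ j≤1+m with m≤n⇒m<n∨m≡n j≤1+m
... | inj₁ j<1+m = p≤ (≤-pred j<1+m)
... | inj₂ refl  = p₁₊ₘ

∀-between? : {P : ℕ → Set} → Decidable P → ∀ a b → Dec (∀ i → a < i → i ≤ b → P i)
∀-between? P? a zero = yes λ i a<i i≤0 → contradiction (≤-trans a<i i≤0) λ ()
∀-between? {P} P? a (suc b) = map′ to from (∀-between? P? a b ×-dec (a <? suc b →-dec P? (suc b)))
  where
  to : (∀ i → a < i → i ≤ b → P i) × (a < suc b → P (suc b)) → ∀ i → a < i → i ≤ suc b → P i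
  to (p≤b , p₁₊b) i a<i i≤1+b =
    ≤-suc-elim {λ j → a < j → P j} p₁₊b (λ j≤b a<j → p≤b _ a<j j≤b) i≤1+b a<i
  from : (∀ i → a < i → i ≤ suc b → P i) → (∀ i → a < i → i ≤ b → P i) × (a < suc b → P (suc b))
  from p = (λ i a<i i≤b → p i a<i (m≤n⇒m≤1+n i≤b)) , (λ a<1+b → p (suc b) a<1+b ≤-refl)

∃-between? : {P : ℕ → Set} → Decidable P → ∀ a b → Dec (∃ λ i → a < i × i ≤ b × P i)
∃-between? P? a zero = no λ (_ , a<i , i≤0 , _) → contradiction (≤-trans a<i i≤0) λ ()
∃-between? {P} P? a (suc b) = map′ to from (∃-between? P? a b ⊎-dec (a <? suc b ×-dec P? (suc b)))
  where
  to : (∃ λ i → a < i × i ≤ b × P i) ⊎ (a < suc b × P (suc b)) → ∃ λ i → a < i × i ≤ suc b × P i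
  to (inj₁ (i , a<i , i≤b , p)) = i , a<i , m≤n⇒m≤1+n i≤b , p
  to (inj₂ (a<1+b , p))         = suc b , a<1+b , ≤-refl , p
  from : (∃ λ i → a < i × i ≤ suc b × P i) → (∃ λ i → a < i × i ≤ b × P i) ⊎ (a < suc b × P (suc b))
  from (i , a<i , i≤1+b , p) with m≤n⇒m<n∨m≡n i≤1+b
  ... | inj₁ i<1+b = inj₁ (i , a<i , ≤-pred i<1+b , p)
  ... | inj₂ refl  = inj₂ (a<i , p)

∃∈? : {A : Set} {P : A → Set} → Decidable P → (xs : List A) → Dec (∃ λ x → x ∈ xs × P x)
∃∈? P? xs = map′ find (λ (_ , x∈xs , p) → lose x∈xs p) (Any.any? P? xs)

module FunctionUpdate {A : Set} (_≟ᴬ_ : DecidableEquality A) where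

  _[_≔_] : {B : Set} → (A → B) → A → B → A → B
  (f [ a ≔ b ]) a′ with a′ ≟ᴬ a
  ... | yes _ = b
  ... | no _  = f a′

  ≔-same : {B : Set} (f : A → B) (a : A) (b : B) → (f [ a ≔ b ]) a ≡ b
  ≔-same f a b with a ≟ᴬ a
  ... | yes _  = refl
  ... | no a≢a = contradiction refl a≢a

  ≔-other : {B : Set} (f : A → B) {a a′ : A} (b : B) → a′ ≢ a → (f [ a ≔ b ]) a′ ≡ f a′
  ≔-other f {a} {a′} b a′≢a with a′ ≟ᴬ a
  ... | yes a′≡a = contradiction a′≡a a′≢a
  ... | no _     = refl

  ≔-self : {B : Set} (f : A → B) (a a′ : A) → (f [ a ≔ f a ]) a′ ≡ f a′
  ≔-self f a a′ with a′ ≟ᴬ a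
  ... | yes refl = refl
  ... | no _     = refl

  ≔-cong : {B : Set} {f g : A → B} {a a′ : A} (b : B) → f a′ ≡ g a′ → (f [ a ≔ b ]) a′ ≡ (g [ a ≔ b ]) a′
  ≔-cong {a = a} {a′} b fa′≡ga′ with a′ ≟ᴬ a
  ... | yes _ = refl
  ... | no _  = fa′≡ga′

  -- P only sees the values on xs: search those, with f₀ supplying all others.
  ∃-local? : ∀ {m} (xs : List A) {P : (A → Fin m) → Set} → Decidable P →
             (∀ {f g} → All (λ a → f a ≡ g a) xs → P f → P g) →
             (f₀ : A → Fin m) → Dec (∃ P)
  ∃-local? [] P? resp f₀ = map′ (f₀ ,_) (λ (_ , p) → resp [] p) (P? f₀)
  ∃-local? (a ∷ xs) {P} P? resp f₀ =
    map′ (λ (v , f , p) → f [ a ≔ v ] , p)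
         (λ (f , p) → f a , f , resp (All.tabulate λ {a′} _ → sym (≔-self f a a′)) p)
         (any? λ v → ∃-local? xs (P? ∘ _[ a ≔ v ]) (resp-≔ v) f₀)
    where
    resp-≔ : ∀ v {f g} → All (λ a′ → f a′ ≡ g a′) xs → P (f [ a ≔ v ]) → P (g [ a ≔ v ])
    resp-≔ v {f} {g} f≗g = resp (trans (≔-same f a v) (sym (≔-same g a v)) ∷ All.map (≔-cong v) f≗g)

_≟ᴵ_ : DecidableEquality Interval
[ a , b ⟩ ≟ᴵ [ c , d ⟩ = map′ (λ { (refl , refl) → refl }) (λ { refl → refl , refl }) (a ≟ c ×-dec b ≟ d)

OnlyLastReaches : ℕ → List Interval → Set
OnlyLastReaches t []       = ⊤
OnlyLastReaches t (J ∷ Js) = hi J ≤ suc t × All (λ J′ → hi J′ ≤ t) Js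

onlyLastReaches⇒all : ∀ {t} Js → OnlyLastReaches t Js → All (λ J → hi J ≤ suc t) Js
onlyLastReaches⇒all []       _           = []
onlyLastReaches⇒all (J ∷ Js) (hJ , hJs) = hJ ∷ All.map m≤n⇒m≤1+n hJs

extendLast-onlyLastReaches : ∀ {t} Js → OnlyLastReaches t Js → OnlyLastReaches (suc t) (extendLast Js)
extendLast-onlyLastReaches []               _           = tt
extendLast-onlyLastReaches ([ a , b ⟩ ∷ Js) (hJ , hJs) = s≤s hJ , All.map m≤n⇒m≤1+n hJs

module Pattern {n : ℕ} (k : ℕ) (σ : ℕ → Fin n) (lev : ℕ → ℕ) where
  open Alg k σ lev
  open FunctionUpdate _≟_ using (_[_≔_]; ≔-same; ≔-other)
  open FunctionUpdate (≡-dec _≟_ _≟ᴵ_) using (∃-local?)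

  -- part branches on does (i ≤? _), which computes to i ≤ᵇ _.
  part-onlyLastReaches : ∀ i t → OnlyLastReaches t (part i t)
  part-onlyLastReaches i zero    = tt
  part-onlyLastReaches i (suc t) with i ≤ᵇ lev (suc t)
  ... | true  = ≤-refl , onlyLastReaches⇒all (part i t) (part-onlyLastReaches i t)
  ... | false = extendLast-onlyLastReaches (part i t) (part-onlyLastReaches i t)

  reaching⇒last : ∀ {t Js J L} → OnlyLastReaches t Js → IsLast Js L → J ∈ Js → t < hi J → J ≡ L
  reaching⇒last _         here (Any.here J≡L)   _     = J≡L
  reaching⇒last (_ , hJs) here (Any.there J∈Js) t<hiJ = contradiction (All.lookup hJs J∈Js) (<⇒≱ t<hiJ)

  extendLast-last : ∀ {Js L} → IsLast Js L → ∃ (IsLast (extendLast Js))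
  extendLast-last (here {[ a , b ⟩}) = _ , here

  part-suc-last : ∀ i t {L} → IsLast (part i t) L → ∃ (IsLast (part i (suc t)))
  part-suc-last i t L-last with i ≤ᵇ lev (suc t)
  ... | true  = _ , here
  ... | false = extendLast-last L-last

  last-exists : lev 1 ≡ k → ∀ {i} t → i ≤ k → 1 ≤ t → ∃ (IsLast (part i t))
  last-exists lev₁≡k {i} (suc zero) i≤k _
    with i ≤ᵇ lev 1 | ≤⇒≤ᵇ (subst (i ≤_) (sym lev₁≡k) i≤k)
  ... | true | _ = _ , here
  last-exists lev₁≡k {i} (suc (suc t)) i≤k _ =
    part-suc-last i (suc t) (proj₂ (last-exists lev₁≡k (suc t) i≤k (s≤s z≤n)))

  last∈ : ∀ {Js L} → IsLast Js L → L ∈ Js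
  last∈ here = Any.here refl

  last? : {P : Interval → Set} → Decidable P → ∀ Js → Dec (∃ λ L → IsLast Js L × P L)
  last? P? []      = no λ { (_ , () , _) }
  last? P? (J ∷ _) = map′ (λ p → J , here , p) (λ { (_ , here , p) → p }) (P? J)

  cells : ℕ → List (ℕ × Interval)
  cells t = concatMap (λ i → map (i ,_) (part i t)) (upTo (suc k))

  ∈-cells : ∀ t {i J} → i ≤ k → J ∈ part i t → (i , J) ∈ cells t
  ∈-cells t {i} {J} i≤k J∈ =
    ∈-concatMap⁺ (λ i → map (i ,_) (part i t))
      (lose {P = λ i′ → (i , J) ∈ map (i′ ,_) (part i′ t)} (∈-upTo⁺ (s≤s i≤k)) (∈-map⁺ (i ,_) J∈))

  _≈[_]_ : Labeling → ℕ → Labeling → Set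
  γ ≈[ t ] γ′ = ∀ {i J} → i ≤ k → J ∈ part i t → γ i J ≡ γ′ i J

  feasible-resp : ∀ t {γ γ′} → γ ≈[ t ] γ′ → Feasible t γ → Feasible t γ′
  feasible-resp _ γ≈γ′ feasible r 1≤r r≤t =
    let i , 1≤i , i≤k , J , J∈ , r∈J , γiJ≡σr = feasible r 1≤r r≤t
    in  i , 1≤i , i≤k , J , J∈ , r∈J , trans (sym (γ≈γ′ i≤k J∈)) γiJ≡σr

  lastLabel-resp : ∀ t {γ γ′ i p} → γ ≈[ t ] γ′ → i ≤ k → LastLabel γ i t p → LastLabel γ′ i t p
  lastLabel-resp _ γ≈γ′ i≤k (L , L-last , γiL≡p) = L , L-last , trans (sym (γ≈γ′ i≤k (last∈ L-last))) γiL≡p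

  feasible? : ∀ t γ → Dec (Feasible t γ)
  feasible? t γ = ∀-between? covered? 0 t
    where
    covered? : Decidable λ r → ∃ λ i → 0 < i × i ≤ k × ∃ λ J → J ∈ part i t × r ∈I J × γ i J ≡ σ r
    covered? r = ∃-between? (λ i → ∃∈? (λ J → (lo J ≤? r ×-dec r <? hi J) ×-dec γ i J Fin.≟ σ r) (part i t)) 0 k

  lastLabel? : ∀ γ i t p → Dec (LastLabel γ i t p)
  lastLabel? γ i t p = last? (λ J → γ i J Fin.≟ p) (part i t)

  -- The labeling argument is only a filler for the cells outside the pattern.
  inQ? : ∀ {ℓ} t → ℓ ≤ k → (s : Config) (x : U) → Labeling → Dec (InQ ℓ t s x)
  inQ? {ℓ} t ℓ≤k s x γ₀ =
    map′ (λ (h , w) → curry h , w) (λ (γ , w) → uncurry γ , w)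
         (∃-local? (cells t) (witness? ∘ curry)
                   (λ h≗h′ → witness-resp λ i≤k J∈ → All.lookup h≗h′ (∈-cells t i≤k J∈))
                   (uncurry γ₀))
    where
    Witness : Labeling → Set
    Witness γ = Feasible t γ × LastLabel γ ℓ t x × (∀ i → ℓ < i → i ≤ k → LastLabel γ i t (s i))

    witness? : ∀ γ → Dec (Witness γ)
    witness? γ = feasible? t γ ×-dec lastLabel? γ ℓ t x ×-dec ∀-between? (λ i → lastLabel? γ i t (s i)) ℓ k

    witness-resp : ∀ {γ γ′} → γ ≈[ t ] γ′ → Witness γ → Witness γ′
    witness-resp γ≈γ′ (feasible , last , above) =
      feasible-resp t γ≈γ′ feasible , lastLabel-resp t γ≈γ′ ℓ≤k last ,
      λ i ℓ<i i≤k → lastLabel-resp t γ≈γ′ i≤k (above i ℓ<i i≤k)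

  inQ-resp-above : ∀ {ℓ t s s′ x} → (∀ i → ℓ < i → s i ≡ s′ i) → InQ ℓ t s x → InQ ℓ t s′ x
  inQ-resp-above {t = t} s≡s′ (γ , feasible , last , above) =
    γ , feasible , last , λ i ℓ<i i≤k → subst (LastLabel γ i t) (s≡s′ i ℓ<i) (above i ℓ<i i≤k)

  Consistent : ℕ → ℕ → Config → Set
  Consistent ℓ t s = Σ Labeling λ γ → Feasible t γ × (∀ i → ℓ < i → i ≤ k → LastLabel γ i t (s i))

  consistent-top : ∀ {t s γ} → Feasible t γ → Consistent k t s
  consistent-top feasible = _ , feasible , λ i k<i i≤k → contradiction i≤k (<⇒≱ k<i)

  inQ⇒consistent : ∀ {ℓ t s} → InQ (suc ℓ) t s (s (suc ℓ)) → Consistent ℓ t s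
  inQ⇒consistent {ℓ} {t} {s} (γ , feasible , last , above) = γ , feasible , above′
    where
    above′ : ∀ i → ℓ < i → i ≤ k → LastLabel γ i t (s i)
    above′ i ℓ<i i≤k with m≤n⇒m<n∨m≡n ℓ<i
    ... | inj₁ 1+ℓ<i = above i 1+ℓ<i i≤k
    ... | inj₂ refl  = last

  consistent-serves : ∀ {t s} → 1 ≤ t → Consistent 0 t s → ∃ λ i → 1 ≤ i × i ≤ k × s i ≡ σ t
  consistent-serves {t} {s} 1≤t (γ , feasible , above) =
    let i , 1≤i , i≤k , J , J∈ , (_ , t<hiJ) , γiJ≡σt = feasible t 1≤t ≤-refl
        L , L-last , γiL≡si = above i 1≤i i≤k
    in  i , 1≤i , i≤k , (begin
          s i   ≡⟨ sym γiL≡si ⟩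
          γ i L ≡⟨ cong (γ i) (sym (reaching⇒last (part-onlyLastReaches i t) L-last J∈ t<hiJ)) ⟩
          γ i J ≡⟨ γiJ≡σt ⟩
          σ t   ∎)
    where open ≡-Reasoning

  consistent⇒inQ : lev 1 ≡ k → ∀ {ℓ t s} → 1 ≤ t → ℓ ≤ k → Consistent ℓ t s → ∃ (InQ ℓ t s)
  consistent⇒inQ lev₁≡k {ℓ} {t} 1≤t ℓ≤k (γ , feasible , above) =
    let L , L-last = last-exists lev₁≡k t ℓ≤k 1≤t
    in  γ ℓ L , γ , feasible , (L , L-last , refl) , above

  inQ⇒consistent-≔ : ∀ {ℓ t s y} → InQ (suc ℓ) t s y → Consistent ℓ t (s [ suc ℓ ≔ y ])
  inQ⇒consistent-≔ {ℓ} {t} {s} {y} y∈Q =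
    inQ⇒consistent (subst (InQ (suc ℓ) t (s [ suc ℓ ≔ y ])) (sym (≔-same s (suc ℓ) y))
                          (inQ-resp-above (λ i 1+ℓ<i → sym (≔-other s y (>⇒≢ 1+ℓ<i))) y∈Q))

  module _ (lev₁≡k : lev 1 ≡ k) {t : ℕ} (1≤t : 1 ≤ t) (old : Config) where

    Completion : ℕ → Bool → Config → Set
    Completion ℓ f s = Σ Config λ new → (∀ i → ℓ < i → new i ≡ s i) × Levels t old new f ℓ

    round : ∀ {ℓ} → ℓ ≤ k → (f : Bool) (s : Config) → Consistent ℓ t s → Completion ℓ f s
    round {zero}  _     _ s _                      = s , (λ _ _ → refl) , done
    round {suc ℓ} 1+ℓ≤k f s consistent@(γ , _) = choose f
      where
      Placed : U → Bool → Set
      Placed y f′ = Σ Config λ new → (∀ i → suc ℓ < i → new i ≡ s i) × new (suc ℓ) ≡ y ×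
                      InQ (suc ℓ) t new (new (suc ℓ)) × Levels t old new f′ ℓ

      place : ∀ {y} → InQ (suc ℓ) t s y → (f′ : Bool) → Placed y f′
      place {y} y∈Q f′ with round (<⇒≤ 1+ℓ≤k) f′ (s [ suc ℓ ≔ y ]) (inQ⇒consistent-≔ y∈Q)
      ... | new , new≡s′ , levels =
        new , agree , new≡y ,
        subst (InQ (suc ℓ) t new) (sym new≡y) (inQ-resp-above (λ i 1+ℓ<i → sym (agree i 1+ℓ<i)) y∈Q) ,
        levels
        where
        agree : ∀ i → suc ℓ < i → new i ≡ s i
        agree i 1+ℓ<i = trans (new≡s′ i (<⇒≤ 1+ℓ<i)) (≔-other s y (>⇒≢ 1+ℓ<i))
        new≡y : new (suc ℓ) ≡ y
        new≡y = trans (new≡s′ (suc ℓ) ≤-refl) (≔-same s (suc ℓ) y)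

      proposal : ∃ (InQ (suc ℓ) t s)
      proposal = consistent⇒inQ lev₁≡k 1≤t 1+ℓ≤k consistent

      choose : (f : Bool) → Completion (suc ℓ) f s
      choose true =
        let new , agree , _ , q , levels = place (proj₂ proposal) true
        in  new , agree , forced (inj₁ refl) q levels
      choose false with suc ℓ ≤? lev t
      ... | yes 1+ℓ≤lev =
        let new , agree , _ , q , levels = place (proj₂ proposal) false
        in  new , agree , forced (inj₂ 1+ℓ≤lev) q levels
      ... | no 1+ℓ≰lev with inQ? t 1+ℓ≤k s (old (suc ℓ)) γ
      ...   | yes old∈Q =
        let new , agree , new≡old , q , levels = place old∈Q false
        in  new , agree , stay (≰⇒> 1+ℓ≰lev) (subst (InQ (suc ℓ) t new) new≡old q) new≡old levels
      ...   | no old∉Q =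
        let new , agree , _ , q , levels = place (proj₂ proposal) true
        in  new , agree , unforced (≰⇒> 1+ℓ≰lev) (old∉Q ∘ inQ-resp-above agree) q levels

  levels⇒inQ : ∀ {t old new f ℓ} → Levels t old new f ℓ → ∀ {j} → j ≤ ℓ → 1 ≤ j → InQ j t new (new j)
  levels⇒inQ done z≤n ()
  levels⇒inQ {t} {new = new} (forced _ q levels) =
    ≤-suc-elim {λ j → 1 ≤ j → InQ j t new (new j)} (λ _ → q) (levels⇒inQ levels)
  levels⇒inQ {t} {new = new} (unforced _ _ q levels) =
    ≤-suc-elim {λ j → 1 ≤ j → InQ j t new (new j)} (λ _ → q) (levels⇒inQ levels)
  levels⇒inQ {t} {new = new} (stay _ q new≡old levels) =
    ≤-suc-elim {λ j → 1 ≤ j → InQ j t new (new j)}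
      (λ _ → subst (InQ _ t new) (sym new≡old) q) (levels⇒inQ levels)

  step⇒consistent : ∀ {t old new γ} → Feasible t γ → Step t old new → ∀ ℓ → ℓ ≤ k → Consistent ℓ t new
  step⇒consistent feasible step ℓ ℓ≤k with m≤n⇒m<n∨m≡n ℓ≤k
  ... | inj₁ ℓ<k = inQ⇒consistent (levels⇒inQ step ℓ<k (s≤s z≤n))
  ... | inj₂ refl = consistent-top feasible

lemma3 : ∀ {n} (k : ℕ) (σ : ℕ → Fin n) (lev : ℕ → ℕ) (T : ℕ) →
    Alg.ValidInput k σ lev T → lev 1 ≡ k →
    -- the algorithm is well defined: every reachable state admits a next round
    (∀ t → 1 ≤ t → t ≤ T → (c : ℕ → Alg.Config k σ lev) →
      Alg.RunUpTo k σ lev (t ∸ 1) c →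
      Σ (Alg.Config k σ lev) λ new → Alg.Step k σ lev t (c (t ∸ 1)) new)
    ×
    -- every possible outcome (probability one) satisfies (1), (2), (3)
    (∀ t → 1 ≤ t → t ≤ T → (c : ℕ → Alg.Config k σ lev) →
      Alg.RunUpTo k σ lev t c →
      (∀ ℓ → ℓ ≤ k → Σ (Alg.Labeling k σ lev) λ γ → Alg.Feasible k σ lev t γ ×
          (∀ i → ℓ < i → i ≤ k → Alg.LastLabel k σ lev γ i t (c t i)))
      ×
      (∀ ℓ → 1 ≤ ℓ → ℓ ≤ k → Σ (Fin n) λ x → Alg.InQ k σ lev ℓ t (c t) x)
      ×
      Σ ℕ λ i → 1 ≤ i × i ≤ k × c t i ≡ σ t)
lemma3 k σ lev T valid lev₁≡k =
  (λ t 1≤t t≤T c _ →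
    let _ , feasible = proj₂ (valid t 1≤t t≤T)
        new , _ , levels = round lev₁≡k 1≤t (c (t ∸ 1)) ≤-refl false (c (t ∸ 1)) (consistent-top feasible)
    in  new , levels) ,
  (λ t 1≤t t≤T c run →
    let _ , feasible = proj₂ (valid t 1≤t t≤T)
        step = run t 1≤t ≤-refl
    in  step⇒consistent feasible step ,
        (λ ℓ 1≤ℓ ℓ≤k → c t ℓ , levels⇒inQ step ℓ≤k 1≤ℓ) ,
        consistent-serves 1≤t (step⇒consistent feasible step 0 z≤n))
  where
  open Pattern k σ lev
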